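{- Let $Q$ be a complete quiver with exactly $2$ frozen vertices, and let $j$ be a mutable vertex that is cycle-preserving for $Q$ and is not the apex of a vortex subquiver of $Q$. Then $\mu_j(Q)$ is brog.
   Context: Quiver: finite directed graph without loops or oriented 2-cycles, vertices partitioned into mutable and frozen, arrows between frozen vertices ignored; $b_{ij}$ = #arrows $i\to j$ − #arrows $j\to i$; $Q|_S$ is the induced subquiver on $S$. Mutation $\mu_j$: for each path $i\xrightarrow{a}j\xrightarrow{b}k$ add $ab$ arrows $i\to k$, reverse arrows at $j$, cancel 2-cycles. Complete: at least one arrow between every pair of vertices at least one of which is mutable. A 3-vertex quiver is an oriented cycle if it has at most one frozen vertex and its underlying directed graph is not acyclic. $j$ is cycle-preserving for $Q$ if whenever $Q|_{ijk}$ is an oriented 3-cycle containing $j$, so is $\mu_j(Q)|_{ijk}$. A vortex is a 4-vertex quiver, at least three of whose vertices are mutable, in which one vertex (the apex) is a source or sink and the other three support an oriented cycle. Red/green: a mutable vertex adjacent to a frozen vertex is red (green) if all arrows between it and frozen vertices point toward (away from) it. Two mutable vertices $i,j$ are complementary if for every frozen $u$ with $b_{iu}\ne0\ne b_{ju}$, $b_{iu}$ and $b_{ju}$ have opposite signs. A quiver is brog if its mutable vertices can be colored blue, red, orange, green so that: the red-colored vertices are exactly the red vertices; the green-colored vertices are exactly the green vertices; each blue $i$ has $b_{ij}\ge0$ for every red $j$ and $b_{ij}\le0$ for every green $j$; each orange $i$ has $b_{ij}\ge0$ for every green $j$ and $b_{ij}\le0$ for every red $j$; every blue vertex and every orange vertex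 are complementary. -}

module Defs where

open import Data.Nat using (ℕ)
open import Data.Bool using (Bool; true; false)
open import Data.Fin using (Fin; _≟_)
open import Data.Integer using (ℤ; _+_; _-_; _*_; -_; _⊔_; _≤_; _<_; 0ℤ)
open import Data.Integer.Properties using (neg-involutive; *-comm; +-comm)
open import Data.Product using (Σ; ∃; ∃-syntax; _×_; _,_)
open import Data.Sum using (_⊎_)
open import Relation.Nullary using (¬_; yes; no)
open import Relation.Binary.PropositionalEquality
  using (_≡_; _≢_; refl; sym; cong; cong₂; trans)
open import Data.Integer.Tactic.RingSolver using (solve-∀)

-- A quiver (no loops, no oriented 2-cycles, arrows between frozen
-- vertices ignored) is encoded by its skew-symmetric exchange matrix
-- b i j = #arrows i→j − #arrows j→i, together with the set of frozen
-- vertices.  Entries b u v with u, v both frozen are never used by any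
-- of the notions below.

record Quiver (n : ℕ) : Set where
  field
    b      : Fin n → Fin n → ℤ
    skew   : ∀ i j → b i j ≡ - b j i
    frozen : Fin n → Bool

open Quiver public

Frozen : ∀ {n} → Quiver n → Fin n → Set
Frozen Q i = frozen Q i ≡ true

Mutable : ∀ {n} → Quiver n → Fin n → Set
Mutable Q i = frozen Q i ≡ false

-- Mutation (matrix mutation, equivalently the quiver mutation rule:
-- for each path i →(a) j →(b) k add ab arrows i → k, reverse arrows
-- at j, cancel 2-cycles).

[_]₊ : ℤ → ℤ
[ x ]₊ = x ⊔ 0ℤ

mutB : ∀ {n} → Fin n → (Fin n → Fin n → ℤ) → Fin n → Fin n → ℤ
mutB j b i k with i ≟ j | k ≟ j
... | yes _ | _     = - b i k
... | no _  | yes _ = - b i k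
... | no _  | no _  = b i k + [ b i j ]₊ * [ b j k ]₊ - [ - b i j ]₊ * [ - b j k ]₊

private
  lem : ∀ x p q r s → x + p * q - r * s ≡ - (- x + s * r - q * p)
  lem = solve-∀

mutB-skew : ∀ {n} (j : Fin n) (b : Fin n → Fin n → ℤ) →
            (∀ i k → b i k ≡ - b k i) → ∀ i k → mutB j b i k ≡ - mutB j b k i
mutB-skew j b sk i k with i ≟ j | k ≟ j
... | yes _ | yes _ = cong -_ (sk i k)
... | yes _ | no _  = cong -_ (sk i k)
... | no _  | yes _ = cong -_ (sk i k)
... | no _  | no _  =
  trans (lem (b i k) [ b i j ]₊ [ b j k ]₊ [ - b i j ]₊ [ - b j k ]₊)
        (cong -_ (e1 (sk k i) (sk k j) (sk j i)))
  where
  e1 : b k i ≡ - b i k → b k j ≡ - b j k → b j i ≡ - b i j →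
       - b i k + [ - b j k ]₊ * [ - b i j ]₊ - [ b j k ]₊ * [ b i j ]₊
       ≡ b k i + [ b k j ]₊ * [ b j i ]₊ - [ - b k j ]₊ * [ - b j i ]₊
  e1 p q r rewrite p | q | r | neg-involutive (b j k) | neg-involutive (b i j) = refl

μ : ∀ {n} → Fin n → Quiver n → Quiver n
μ j Q = record
  { b      = mutB j (b Q)
  ; skew   = mutB-skew j (b Q) (skew Q)
  ; frozen = frozen Q
  }

ExactlyTwoFrozen : ∀ {n} → Quiver n → Set
ExactlyTwoFrozen {n} Q =
  Σ (Fin n) λ u → Σ (Fin n) λ v →
    u ≢ v × Frozen Q u × Frozen Q v × (∀ w → Frozen Q w → w ≡ u ⊎ w ≡ v)

Complete : ∀ {n} → Quiver n → Set
Complete Q = ∀ i k → i ≢ k → (Mutable Q i ⊎ Mutable Q k) → b Q i k ≢ 0ℤ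

AtMostOneFrozen₃ : ∀ {n} → Quiver n → Fin n → Fin n → Fin n → Set
AtMostOneFrozen₃ Q i j k =
  (Mutable Q i × Mutable Q j) ⊎ (Mutable Q j × Mutable Q k) ⊎ (Mutable Q i × Mutable Q k)

Distinct₃ : ∀ {n} → Fin n → Fin n → Fin n → Set
Distinct₃ i j k = i ≢ j × j ≢ k × i ≢ k

-- The underlying directed graph of Q|{i,j,k} (i,j,k distinct) is not
-- acyclic.  Since there are no loops and no oriented 2-cycles, a
-- directed cycle on three vertices is one of the two oriented 3-cycles.
HasDirectedCycle₃ : ∀ {n} → Quiver n → Fin n → Fin n → Fin n → Set
HasDirectedCycle₃ Q i j k =
  (0ℤ < b Q i j × 0ℤ < b Q j k × 0ℤ < b Q k i) ⊎
  (0ℤ < b Q i k × 0ℤ < b Q k j × 0ℤ < b Q j i)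

OrientedCycle : ∀ {n} → Quiver n → Fin n → Fin n → Fin n → Set
OrientedCycle Q i j k =
  Distinct₃ i j k × AtMostOneFrozen₃ Q i j k × HasDirectedCycle₃ Q i j k

-- j is cycle-preserving for Q (Q|{i,j,k} has vertex set {i,j,k}
-- containing j; the order of listing is irrelevant to OrientedCycle)
CyclePreserving : ∀ {n} → Quiver n → Fin n → Set
CyclePreserving Q j =
  ∀ i k → OrientedCycle Q i j k → OrientedCycle (μ j Q) i j k

SourceIn : ∀ {n} → Quiver n → Fin n → Fin n → Fin n → Fin n → Set
SourceIn Q a x y z = 0ℤ ≤ b Q a x × 0ℤ ≤ b Q a y × 0ℤ ≤ b Q a z

SinkIn : ∀ {n} → Quiver n → Fin n → Fin n → Fin n → Fin n → Set
SinkIn Q a x y z = b Q a x ≤ 0ℤ × b Q a y ≤ 0ℤ × b Q a z ≤ 0ℤ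

AtLeastThreeMutable₄ : ∀ {n} → Quiver n → Fin n → Fin n → Fin n → Fin n → Set
AtLeastThreeMutable₄ Q a x y z =
  (Mutable Q a × Mutable Q x × Mutable Q y) ⊎
  (Mutable Q a × Mutable Q x × Mutable Q z) ⊎
  (Mutable Q a × Mutable Q y × Mutable Q z) ⊎
  (Mutable Q x × Mutable Q y × Mutable Q z)

VortexWithApex : ∀ {n} → Quiver n → Fin n → Fin n → Fin n → Fin n → Set
VortexWithApex Q a x y z =
  a ≢ x × a ≢ y × a ≢ z × Distinct₃ x y z ×
  AtLeastThreeMutable₄ Q a x y z ×
  (SourceIn Q a x y z ⊎ SinkIn Q a x y z) ×
  OrientedCycle Q x y z

IsVortexApex : ∀ {n} → Quiver n → Fin n → Set
IsVortexApex {n} Q j = ∃[ x ] ∃[ y ] ∃[ z ] VortexWithApex Q j x y z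

AdjacentToFrozen : ∀ {n} → Quiver n → Fin n → Set
AdjacentToFrozen Q i = ∃[ u ] (Frozen Q u × b Q i u ≢ 0ℤ)

Red : ∀ {n} → Quiver n → Fin n → Set
Red Q i = Mutable Q i × AdjacentToFrozen Q i × (∀ u → Frozen Q u → b Q i u ≤ 0ℤ)

Green : ∀ {n} → Quiver n → Fin n → Set
Green Q i = Mutable Q i × AdjacentToFrozen Q i × (∀ u → Frozen Q u → 0ℤ ≤ b Q i u)

Complementary : ∀ {n} → Quiver n → Fin n → Fin n → Set
Complementary Q i j =
  ∀ u → Frozen Q u → b Q i u ≢ 0ℤ → b Q j u ≢ 0ℤ → b Q i u * b Q j u < 0ℤ

data Colour : Set where
  blue red orange green : Colour

-- a colouring of the mutable vertices (the value at frozen vertices is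
-- irrelevant) satisfying the brog conditions
IsBrogColouring : ∀ {n} → Quiver n → (Fin n → Colour) → Set
IsBrogColouring Q c =
  (∀ i → Mutable Q i → (c i ≡ red → Red Q i) × (Red Q i → c i ≡ red)) ×
  (∀ i → Mutable Q i → (c i ≡ green → Green Q i) × (Green Q i → c i ≡ green)) ×
  (∀ i j → Mutable Q i → Mutable Q j → c i ≡ blue → c j ≡ red → 0ℤ ≤ b Q i j) ×
  (∀ i j → Mutable Q i → Mutable Q j → c i ≡ blue → c j ≡ green → b Q i j ≤ 0ℤ) ×
  (∀ i j → Mutable Q i → Mutable Q j → c i ≡ orange → c j ≡ green → 0ℤ ≤ b Q i j) ×
  (∀ i j → Mutable Q i → Mutable Q j → c i ≡ orange → c j ≡ red → b Q i j ≤ 0ℤ) ×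
  (∀ i j → Mutable Q i → Mutable Q j → c i ≡ blue → c j ≡ orange → Complementary Q i j)

Brog : ∀ {n} → Quiver n → Set
Brog {n} Q = Σ (Fin n → Colour) λ c → IsBrogColouring Q c

{-# OPTIONS --safe #-}
module Submission where

-- After mutating at j, every triangle through j is oriented: for x → j → y in Q,
-- an arrow x → y only grows, while if y → x, the cycle x → j → y → x stays
-- oriented because j is cycle-preserving, and this forces x → y.  No triangle
-- avoiding j is oriented: if its vertices lie on both sides of j, one of its
-- arrows opposes such a forced arrow; if all lie on one side, the mutation does
-- not touch it, and in Q it would be a vortex with apex j.  With two frozen
-- vertices these two facts make the colouring "red, green, j orange, all other
-- vertices blue" a brog colouring.

open import Defs
open import Data.Fin using (Fin; _≟_)
open import Data.Integer
  using (0ℤ; +0; +[1+_]; -[1+_]; _<_; _≤_; -_; _+_; _-_; _*_; +<+; -<+)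
open import Data.Integer.Properties
  using ( _≤?_; <⇒≤; <⇒≢; ≤∧≢⇒<; <-asym; <-cmp; ≮⇒≥; ≰⇒>; ≤⇒≯; neg-mono-<
        ; +-mono-<; +-identityʳ; *-zeroˡ; *-zeroʳ; i≤j⇒i⊔j≡j; i≥j⇒i⊔j≡i)
open import Data.Nat using (z<s)
open import Data.Product using (Σ; ∃-syntax; _×_; _,_; proj₁; proj₂)
open import Data.Sum using (_⊎_; inj₁; inj₂; swap)
open import Data.Empty using (⊥; ⊥-elim)
open import Relation.Nullary using (¬_; yes; no)
open import Relation.Nullary.Decidable using (toSum)
open import Relation.Binary.Definitions using (tri<; tri≈; tri>)
open import Relation.Binary.PropositionalEquality
  using (_≡_; _≢_; refl; sym; trans; cong; cong₂; subst; ≢-sym; module ≡-Reasoning)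

*-pos : ∀ {a c} → 0ℤ < a → 0ℤ < c → 0ℤ < a * c
*-pos {+[1+ _ ]} {+[1+ _ ]} _ _ = +<+ z<s
*-pos {+0} (+<+ ()) _
*-pos { -[1+ _ ]} () _
*-pos {+[1+ _ ]} {+0} _ (+<+ ())
*-pos {+[1+ _ ]} { -[1+ _ ]} _ ()

opposite-signs⇒*<0 : ∀ {a c} → a ≢ 0ℤ → c ≢ 0ℤ →
  ¬ (0ℤ < a × 0ℤ < c) → ¬ (a < 0ℤ × c < 0ℤ) → a * c < 0ℤ
opposite-signs⇒*<0 {+0} a≢0 _ _ _ = ⊥-elim (a≢0 refl)
opposite-signs⇒*<0 {c = +0} _ c≢0 _ _ = ⊥-elim (c≢0 refl)
opposite-signs⇒*<0 {+[1+ _ ]} {+[1+ _ ]} _ _ ¬pos _ = ⊥-elim (¬pos (+<+ z<s , +<+ z<s))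
opposite-signs⇒*<0 {+[1+ _ ]} { -[1+ _ ]} _ _ _ _ = -<+
opposite-signs⇒*<0 { -[1+ _ ]} {+[1+ _ ]} _ _ _ _ = -<+
opposite-signs⇒*<0 { -[1+ _ ]} { -[1+ _ ]} _ _ _ ¬neg = ⊥-elim (¬neg (-<+ , -<+))

pos-part-of-neg : ∀ {a} → a < 0ℤ → [ a ]₊ ≡ 0ℤ
pos-part-of-neg a<0 = i≤j⇒i⊔j≡j (<⇒≤ a<0)

pos-part-of-pos : ∀ {a} → 0ℤ < a → [ a ]₊ ≡ a
pos-part-of-pos 0<a = i≥j⇒i⊔j≡i (<⇒≤ 0<a)

pos-part-of-neg-*ˡ : ∀ {a} c → a < 0ℤ → [ a ]₊ * c ≡ 0ℤ
pos-part-of-neg-*ˡ c a<0 = trans (cong (_* c) (pos-part-of-neg a<0)) (*-zeroˡ c)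

pos-part-of-neg-*ʳ : ∀ {a} c → a < 0ℤ → c * [ a ]₊ ≡ 0ℤ
pos-part-of-neg-*ʳ c a<0 = trans (cong (c *_) (pos-part-of-neg a<0)) (*-zeroʳ c)

Arrow : ∀ {n} → Quiver n → Fin n → Fin n → Set
Arrow P x y = 0ℤ < b P x y

module _ {n} (P : Quiver n) where

  arrow⇒reverse<0 : ∀ {x y} → Arrow P x y → b P y x < 0ℤ
  arrow⇒reverse<0 {x} {y} xy = subst (_< 0ℤ) (sym (skew P y x)) (neg-mono-< xy)

  <0⇒reverse-arrow : ∀ {x y} → b P x y < 0ℤ → Arrow P y x
  <0⇒reverse-arrow {x} {y} xy<0 = subst (0ℤ <_) (sym (skew P y x)) (neg-mono-< xy<0)

  arrow-asym : ∀ {x y} → Arrow P x y → ¬ Arrow P y x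
  arrow-asym xy = <-asym (arrow⇒reverse<0 xy)

  arrow⇒≢ : ∀ {x y} → Arrow P x y → x ≢ y
  arrow⇒≢ xx refl = arrow-asym xx xx

  path⇒ends≢ : ∀ {x y z} → Arrow P x y → Arrow P y z → x ≢ z
  path⇒ends≢ xy yx refl = arrow-asym xy yx

  ¬reverse-arrow⇒≥0 : ∀ {x y} → ¬ Arrow P y x → 0ℤ ≤ b P x y
  ¬reverse-arrow⇒≥0 ¬yx = ≮⇒≥ (λ xy<0 → ¬yx (<0⇒reverse-arrow xy<0))

  mutable≢frozen : ∀ {x w} → Mutable P x → Frozen P w → x ≢ w
  mutable≢frozen mx fw refl with trans (sym mx) fw
  ... | ()

  module _ (complete : Complete P) {x y : Fin n} (x≢y : x ≢ y)
           (m : Mutable P x ⊎ Mutable P y) where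

    complete⇒arrow : Arrow P x y ⊎ Arrow P y x
    complete⇒arrow with <-cmp 0ℤ (b P x y)
    ... | tri< xy _ _ = inj₁ xy
    ... | tri≈ _ 0≡xy _ = ⊥-elim (complete x y x≢y m (sym 0≡xy))
    ... | tri> _ _ xy<0 = inj₂ (<0⇒reverse-arrow xy<0)

    ≤0⇒reverse-arrow : b P x y ≤ 0ℤ → Arrow P y x
    ≤0⇒reverse-arrow xy≤0 = <0⇒reverse-arrow (≤∧≢⇒< xy≤0 (complete x y x≢y m))

    ≥0⇒arrow : 0ℤ ≤ b P x y → Arrow P x y
    ≥0⇒arrow 0≤xy = ≤∧≢⇒< 0≤xy (≢-sym (complete x y x≢y m))

AllTrianglesThroughOriented : ∀ {n} → Quiver n → Fin n → Set
AllTrianglesThroughOriented P j = ∀ {x y} → x ≢ y → Mutable P x ⊎ Mutable P y →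
  Arrow P x j → Arrow P j y → Arrow P y x

-- Requiring x and y mutable is, up to rotating the cycle, "at most one frozen vertex".
NoOrientedTriangleAvoiding : ∀ {n} → Quiver n → Fin n → Set
NoOrientedTriangleAvoiding P j = ∀ {x y z} → Mutable P x → Mutable P y →
  x ≢ j → y ≢ j → z ≢ j → Arrow P x y → Arrow P y z → ¬ Arrow P z x

module TwoFrozen {n} (P : Quiver n) (j : Fin n)
  (complete : Complete P) (j-mutable : Mutable P j)
  (u v : Fin n) (u-frozen : Frozen P u) (v-frozen : Frozen P v)
  (frozen-u-or-v : ∀ w → Frozen P w → w ≡ u ⊎ w ≡ v)
  (through : AllTrianglesThroughOriented P j)
  (avoiding : NoOrientedTriangleAvoiding P j) where

  frozen≢j : ∀ {w} → Frozen P w → w ≢ j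
  frozen≢j fw = ≢-sym (mutable≢frozen P j-mutable fw)

  on-frozen : (A : Fin n → Set) → A u → A v → ∀ w → Frozen P w → A w
  on-frozen A Au Av w fw with frozen-u-or-v w fw
  ... | inj₁ refl = Au
  ... | inj₂ refl = Av

  no-three-frozen : ∀ {w₁ w₂ w₃} → Frozen P w₁ → Frozen P w₂ → Frozen P w₃ →
    w₁ ≢ w₂ → w₂ ≢ w₃ → w₁ ≢ w₃ → ⊥
  no-three-frozen {w₁} {w₂} {w₃} f₁ f₂ f₃ ≢₁₂ ≢₂₃ ≢₁₃
    with frozen-u-or-v w₁ f₁ | frozen-u-or-v w₂ f₂ | frozen-u-or-v w₃ f₃
  ... | inj₁ e₁ | inj₁ e₂ | _      = ≢₁₂ (trans e₁ (sym e₂))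
  ... | inj₂ e₁ | inj₂ e₂ | _      = ≢₁₂ (trans e₁ (sym e₂))
  ... | inj₁ e₁ | inj₂ _  | inj₁ e₃ = ≢₁₃ (trans e₁ (sym e₃))
  ... | inj₂ e₁ | inj₁ _  | inj₂ e₃ = ≢₁₃ (trans e₁ (sym e₃))
  ... | inj₁ _  | inj₂ e₂ | inj₂ e₃ = ≢₂₃ (trans e₂ (sym e₃))
  ... | inj₂ _  | inj₁ e₂ | inj₁ e₃ = ≢₂₃ (trans e₂ (sym e₃))

  no-shortcut : ∀ {x y} → x ≢ y → Mutable P x ⊎ Mutable P y →
    Arrow P x j → Arrow P j y → ¬ Arrow P x y
  no-shortcut x≢y m xj jy = arrow-asym P (through x≢y m xj jy)

  RedSign GreenSign ArrowToFrozen ArrowFromFrozen : Fin n → Set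
  RedSign x = ∀ w → Frozen P w → b P x w ≤ 0ℤ
  GreenSign x = ∀ w → Frozen P w → 0ℤ ≤ b P x w
  ArrowToFrozen x = ∃[ w ] Frozen P w × Arrow P x w
  ArrowFromFrozen x = ∃[ w ] Frozen P w × Arrow P w x

  redSign-or-arrowToFrozen : ∀ x → RedSign x ⊎ ArrowToFrozen x
  redSign-or-arrowToFrozen x with b P x u ≤? 0ℤ | b P x v ≤? 0ℤ
  ... | yes xu | yes xv = inj₁ (on-frozen (λ w → b P x w ≤ 0ℤ) xu xv)
  ... | no xu  | _      = inj₂ (u , u-frozen , ≰⇒> xu)
  ... | yes _  | no xv  = inj₂ (v , v-frozen , ≰⇒> xv)

  greenSign-or-arrowFromFrozen : ∀ x → GreenSign x ⊎ ArrowFromFrozen x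
  greenSign-or-arrowFromFrozen x with 0ℤ ≤? b P x u | 0ℤ ≤? b P x v
  ... | yes ux | yes vx = inj₁ (on-frozen (λ w → 0ℤ ≤ b P x w) ux vx)
  ... | no ux  | _      = inj₂ (u , u-frozen , <0⇒reverse-arrow P (≰⇒> ux))
  ... | yes _  | no vx  = inj₂ (v , v-frozen , <0⇒reverse-arrow P (≰⇒> vx))

  arrowToFrozen⇒¬redSign : ∀ {x} → ArrowToFrozen x → ¬ RedSign x
  arrowToFrozen⇒¬redSign (w , fw , xw) s = ≤⇒≯ (s w fw) xw

  arrowFromFrozen⇒¬greenSign : ∀ {x} → ArrowFromFrozen x → ¬ GreenSign x
  arrowFromFrozen⇒¬greenSign (w , fw , wx) s = ≤⇒≯ (s w fw) (arrow⇒reverse<0 P wx)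

  redSign⇒arrowFrom : ∀ {x w} → Mutable P x → RedSign x → Frozen P w → Arrow P w x
  redSign⇒arrowFrom {x} {w} mx s fw =
    ≤0⇒reverse-arrow P complete (mutable≢frozen P mx fw) (inj₁ mx) (s w fw)

  greenSign⇒arrowTo : ∀ {x w} → Mutable P x → GreenSign x → Frozen P w → Arrow P x w
  greenSign⇒arrowTo {x} {w} mx s fw =
    ≥0⇒arrow P complete (mutable≢frozen P mx fw) (inj₁ mx) (s w fw)

  data ColourSpec (x : Fin n) : Colour → Set where
    red    : RedSign x → ColourSpec x red
    green  : ArrowToFrozen x → GreenSign x → ColourSpec x green
    orange : ArrowToFrozen x → ArrowFromFrozen x → x ≡ j → ColourSpec x orange
    blue   : ArrowToFrozen x → ArrowFromFrozen x → x ≢ j → ColourSpec x blue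

  classify : ∀ x → Σ Colour (ColourSpec x)
  classify x with redSign-or-arrowToFrozen x | greenSign-or-arrowFromFrozen x | x ≟ j
  ... | inj₁ s | _      | _       = red , red s
  ... | inj₂ t | inj₁ s | _       = green , green t s
  ... | inj₂ t | inj₂ f | yes x≡j = orange , orange t f x≡j
  ... | inj₂ t | inj₂ f | no x≢j  = blue , blue t f x≢j

  colour : Fin n → Colour
  colour x = proj₁ (classify x)

  colour-spec : ∀ {x c} → colour x ≡ c → ColourSpec x c
  colour-spec {x} refl = proj₂ (classify x)

  redSign⇒red : ∀ {x c} → ColourSpec x c → RedSign x → c ≡ red
  redSign⇒red (red _)        _ = refl
  redSign⇒red (green t _)    s = ⊥-elim (arrowToFrozen⇒¬redSign t s)
  redSign⇒red (orange t _ _) s = ⊥-elim (arrowToFrozen⇒¬redSign t s)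
  redSign⇒red (blue t _ _)   s = ⊥-elim (arrowToFrozen⇒¬redSign t s)

  greenSign⇒green : ∀ {x c} → Mutable P x → ColourSpec x c → GreenSign x → c ≡ green
  greenSign⇒green mx (red r) s =
    ⊥-elim (arrowFromFrozen⇒¬greenSign (u , u-frozen , redSign⇒arrowFrom mx r u-frozen) s)
  greenSign⇒green _ (green _ _)    _ = refl
  greenSign⇒green _ (orange _ f _) s = ⊥-elim (arrowFromFrozen⇒¬greenSign f s)
  greenSign⇒green _ (blue _ f _)   s = ⊥-elim (arrowFromFrozen⇒¬greenSign f s)

  adjacent : ∀ {x} → Mutable P x → AdjacentToFrozen P x
  adjacent mx = u , u-frozen , complete _ u (mutable≢frozen P mx u-frozen) (inj₁ mx)

  red-iff : ∀ i → Mutable P i →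
    (colour i ≡ red → Red P i) × (Red P i → colour i ≡ red)
  red-iff i mi =
    (λ c → from (colour-spec c)) , λ (_ , _ , s) → redSign⇒red (colour-spec refl) s
    where
    from : ColourSpec i red → Red P i
    from (red s) = mi , adjacent mi , s

  green-iff : ∀ i → Mutable P i →
    (colour i ≡ green → Green P i) × (Green P i → colour i ≡ green)
  green-iff i mi =
    (λ c → from (colour-spec c)) , λ (_ , _ , s) → greenSign⇒green mi (colour-spec refl) s
    where
    from : ColourSpec i green → Green P i
    from (green _ s) = mi , adjacent mi , s

  blue-red : ∀ i r → Mutable P i → Mutable P r → colour i ≡ blue → colour r ≡ red →
    0ℤ ≤ b P i r
  blue-red i r mi mr ci cr with colour-spec ci | colour-spec cr | r ≟ j
  ... | blue _ (w , fw , wi) _ | red s | yes refl = ¬reverse-arrow⇒≥0 P λ ji →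
    no-shortcut (≢-sym (mutable≢frozen P mi fw)) (inj₂ mi) (redSign⇒arrowFrom mr s fw) ji wi
  ... | blue (w , fw , iw) _ i≢j | red s | no r≢j = ¬reverse-arrow⇒≥0 P λ ri →
    avoiding mr mi r≢j i≢j (frozen≢j fw) ri iw (redSign⇒arrowFrom mr s fw)

  blue-green : ∀ i g → Mutable P i → Mutable P g → colour i ≡ blue → colour g ≡ green →
    b P i g ≤ 0ℤ
  blue-green i g mi mg ci cg with colour-spec ci | colour-spec cg | g ≟ j
  ... | blue (w , fw , iw) _ _ | green _ s | yes refl = ≮⇒≥ λ ij →
    no-shortcut (mutable≢frozen P mi fw) (inj₁ mi) ij (greenSign⇒arrowTo mg s fw) iw
  ... | blue _ (w , fw , wi) i≢j | green _ s | no g≢j = ≮⇒≥ λ ig →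
    avoiding mi mg i≢j g≢j (frozen≢j fw) ig (greenSign⇒arrowTo mg s fw) wi

  orange-green : ∀ i g → Mutable P i → Mutable P g → colour i ≡ orange → colour g ≡ green →
    0ℤ ≤ b P i g
  orange-green i g _ mg ci cg with colour-spec ci | colour-spec cg
  ... | orange (w , fw , jw) _ refl | green _ s = ¬reverse-arrow⇒≥0 P λ gj →
    no-shortcut (mutable≢frozen P mg fw) (inj₁ mg) gj jw (greenSign⇒arrowTo mg s fw)

  orange-red : ∀ i r → Mutable P i → Mutable P r → colour i ≡ orange → colour r ≡ red →
    b P i r ≤ 0ℤ
  orange-red i r _ mr ci cr with colour-spec ci | colour-spec cr
  ... | orange _ (w , fw , wj) refl | red s = ≮⇒≥ λ jr →
    no-shortcut (≢-sym (mutable≢frozen P mr fw)) (inj₂ mr) wj jr (redSign⇒arrowFrom mr s fw)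

  -- The case that no-shortcut leaves open would need three distinct frozen vertices.
  not-both-into : ∀ {i w} → Mutable P i → i ≢ j → ArrowFromFrozen i → ArrowFromFrozen j →
    Frozen P w → ¬ (Arrow P i w × Arrow P j w)
  not-both-into {i} mi i≢j (w₁ , f₁ , w₁i) (w₂ , f₂ , w₂j) fw (iw , jw)
    with complete⇒arrow P complete i≢j (inj₁ mi)
  ... | inj₁ ij = no-shortcut (mutable≢frozen P mi fw) (inj₁ mi) ij jw iw
  ... | inj₂ ji = no-three-frozen f₁ f₂ fw
    (path⇒ends≢ P w₁i iw₂) (path⇒ends≢ P w₂j jw) (path⇒ends≢ P w₁i iw)
    where
    iw₂ : Arrow P i w₂
    iw₂ = through (≢-sym (mutable≢frozen P mi f₂)) (inj₂ mi) w₂j ji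

  not-both-out : ∀ {i w} → Mutable P i → i ≢ j → ArrowToFrozen i → ArrowToFrozen j →
    Frozen P w → ¬ (Arrow P w i × Arrow P w j)
  not-both-out {i} mi i≢j (w₁ , f₁ , iw₁) (w₂ , f₂ , jw₂) fw (wi , wj)
    with complete⇒arrow P complete i≢j (inj₁ mi)
  ... | inj₂ ji = no-shortcut (≢-sym (mutable≢frozen P mi fw)) (inj₂ mi) wj ji wi
  ... | inj₁ ij = no-three-frozen f₂ f₁ fw
    (path⇒ends≢ P w₂i iw₁) (≢-sym (path⇒ends≢ P wi iw₁)) (≢-sym (path⇒ends≢ P wj jw₂))
    where
    w₂i : Arrow P w₂ i
    w₂i = through (mutable≢frozen P mi f₂) (inj₁ mi) ij jw₂

  blue-orange : ∀ i k → Mutable P i → Mutable P k → colour i ≡ blue → colour k ≡ orange →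
    Complementary P i k
  blue-orange i k mi _ ci ck with colour-spec ci | colour-spec ck
  ... | blue ti fi i≢j | orange tj fj refl = λ w fw iw≢0 jw≢0 →
    opposite-signs⇒*<0 iw≢0 jw≢0 (not-both-into mi i≢j fi fj fw)
      (λ (iw<0 , jw<0) →
        not-both-out mi i≢j ti tj fw (<0⇒reverse-arrow P iw<0 , <0⇒reverse-arrow P jw<0))

  brog : Brog P
  brog = colour , red-iff , green-iff ,
         blue-red , blue-green , orange-green , orange-red , blue-orange

module _ {n} (Q : Quiver n) (j : Fin n) where

  μ-b-into-j : ∀ x → b (μ j Q) x j ≡ b Q j x
  μ-b-into-j x with x ≟ j | j ≟ j
  ... | yes _ | _      = sym (skew Q j x)
  ... | no _  | yes _  = sym (skew Q j x)
  ... | no _  | no j≢j = ⊥-elim (j≢j refl)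

  μ-b-from-j : ∀ x → b (μ j Q) j x ≡ b Q x j
  μ-b-from-j x with j ≟ j
  ... | yes _  = sym (skew Q x j)
  ... | no j≢j = ⊥-elim (j≢j refl)

  μ-b-off-j : ∀ {x y} → x ≢ j → y ≢ j →
    b (μ j Q) x y ≡ b Q x y + [ b Q x j ]₊ * [ b Q j y ]₊ - [ - b Q x j ]₊ * [ - b Q j y ]₊
  μ-b-off-j {x} {y} x≢j y≢j with x ≟ j | y ≟ j
  ... | yes x≡j | _       = ⊥-elim (x≢j x≡j)
  ... | no _    | yes y≡j = ⊥-elim (y≢j y≡j)
  ... | no _    | no _    = refl

  μ-b-off-j-adding : ∀ {x y p} → x ≢ j → y ≢ j →
    [ b Q x j ]₊ * [ b Q j y ]₊ ≡ p → [ - b Q x j ]₊ * [ - b Q j y ]₊ ≡ 0ℤ →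
    b (μ j Q) x y ≡ b Q x y + p
  μ-b-off-j-adding {x} {y} {p} x≢j y≢j added subtracted = begin
    b (μ j Q) x y
      ≡⟨ μ-b-off-j x≢j y≢j ⟩
    b Q x y + [ b Q x j ]₊ * [ b Q j y ]₊ - [ - b Q x j ]₊ * [ - b Q j y ]₊
      ≡⟨ cong₂ (λ s t → b Q x y + s - t) added subtracted ⟩
    b Q x y + p - 0ℤ
      ≡⟨ +-identityʳ _ ⟩
    b Q x y + p ∎
    where open ≡-Reasoning

  μ-b-both-into-j : ∀ {x y} → Arrow Q x j → Arrow Q y j → b (μ j Q) x y ≡ b Q x y
  μ-b-both-into-j {x} {y} xj yj = trans
    (μ-b-off-j-adding (arrow⇒≢ Q xj) (arrow⇒≢ Q yj)
      (pos-part-of-neg-*ʳ [ b Q x j ]₊ (arrow⇒reverse<0 Q yj))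
      (pos-part-of-neg-*ˡ [ - b Q j y ]₊ (neg-mono-< xj)))
    (+-identityʳ _)

  μ-b-both-out-of-j : ∀ {x y} → Arrow Q j x → Arrow Q j y → b (μ j Q) x y ≡ b Q x y
  μ-b-both-out-of-j {x} {y} jx jy = trans
    (μ-b-off-j-adding (≢-sym (arrow⇒≢ Q jx)) (≢-sym (arrow⇒≢ Q jy))
      (pos-part-of-neg-*ˡ [ b Q j y ]₊ (arrow⇒reverse<0 Q jx))
      (pos-part-of-neg-*ʳ [ - b Q x j ]₊ (neg-mono-< jy)))
    (+-identityʳ _)

  μ-b-through-j : ∀ {x y} → Arrow Q x j → Arrow Q j y →
    b (μ j Q) x y ≡ b Q x y + b Q x j * b Q j y
  μ-b-through-j {x} {y} xj jy = μ-b-off-j-adding (arrow⇒≢ Q xj) (≢-sym (arrow⇒≢ Q jy))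
    (cong₂ _*_ (pos-part-of-pos xj) (pos-part-of-pos jy))
    (pos-part-of-neg-*ˡ [ - b Q j y ]₊ (neg-mono-< xj))

  μ-arrow-into-j : ∀ {x} → Arrow (μ j Q) x j → Arrow Q j x
  μ-arrow-into-j {x} = subst (0ℤ <_) (μ-b-into-j x)

  μ-arrow-from-j : ∀ {x} → Arrow (μ j Q) j x → Arrow Q x j
  μ-arrow-from-j {x} = subst (0ℤ <_) (μ-b-from-j x)

  μ-arrow-both-into-j : ∀ {x y} → Arrow Q x j → Arrow Q y j → Arrow (μ j Q) x y → Arrow Q x y
  μ-arrow-both-into-j xj yj = subst (0ℤ <_) (μ-b-both-into-j xj yj)

  μ-arrow-both-out-of-j : ∀ {x y} → Arrow Q j x → Arrow Q j y → Arrow (μ j Q) x y → Arrow Q x y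
  μ-arrow-both-out-of-j jx jy = subst (0ℤ <_) (μ-b-both-out-of-j jx jy)

module CyclePreservingMutation {n} (Q : Quiver n) (j : Fin n)
  (complete : Complete Q) (j-mutable : Mutable Q j) (preserving : CyclePreserving Q j) where

  side : ∀ {x} → x ≢ j → Arrow Q x j ⊎ Arrow Q j x
  side x≢j = complete⇒arrow Q complete x≢j (inj₂ j-mutable)

  at-most-one-frozen-with-j : ∀ {x y} → Mutable Q x ⊎ Mutable Q y → AtMostOneFrozen₃ Q x j y
  at-most-one-frozen-with-j (inj₁ mx) = inj₁ (mx , j-mutable)
  at-most-one-frozen-with-j (inj₂ my) = inj₂ (inj₁ (j-mutable , my))

  -- If y → x, then x → j → y → x is an oriented cycle through j, and after the
  -- mutation the only orientation compatible with j → x is the one with x → y.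
  μ-shortcut-arrow : ∀ {x y} → Arrow Q x j → Arrow Q j y → x ≢ y →
    Mutable Q x ⊎ Mutable Q y → Arrow (μ j Q) x y
  μ-shortcut-arrow {x} {y} xj jy x≢y m with complete⇒arrow Q complete x≢y m
  ... | inj₁ xy = subst (0ℤ <_) (sym (μ-b-through-j Q j xj jy)) (+-mono-< xy (*-pos xj jy))
  ... | inj₂ yx
    with preserving x y ((arrow⇒≢ Q xj , arrow⇒≢ Q jy , x≢y) ,
                         at-most-one-frozen-with-j m , inj₁ (xj , jy , yx))
  ...   | _ , _ , inj₁ (μxj , _ , _) = ⊥-elim (arrow-asym Q xj (μ-arrow-into-j Q j μxj))
  ...   | _ , _ , inj₂ (μxy , _ , _) = μxy

  μ-no-reverse-shortcut : ∀ {x y} → Arrow Q j x → Arrow Q y j →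
    Mutable Q x ⊎ Mutable Q y → ¬ Arrow (μ j Q) x y
  μ-no-reverse-shortcut {x} {y} jx yj m xy =
    arrow-asym (μ j Q) {y} {x}
      (μ-shortcut-arrow yj jx (≢-sym (arrow⇒≢ (μ j Q) {x} {y} xy)) (swap m)) xy

  μ-all-triangles-through-oriented : AllTrianglesThroughOriented (μ j Q) j
  μ-all-triangles-through-oriented x≢y m xj jy =
    μ-shortcut-arrow (μ-arrow-from-j Q j jy) (μ-arrow-into-j Q j xj) (≢-sym x≢y) (swap m)

  μ-complete : Complete (μ j Q)
  μ-complete x y x≢y m with toSum (x ≟ j) | toSum (y ≟ j)
  ... | inj₁ refl | _ = λ jy≡0 →
    complete y j (≢-sym x≢y) (swap m) (trans (sym (μ-b-from-j Q j y)) jy≡0)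
  ... | inj₂ _ | inj₁ refl = λ xj≡0 →
    complete j x (≢-sym x≢y) (swap m) (trans (sym (μ-b-into-j Q j x)) xj≡0)
  ... | inj₂ x≢j | inj₂ y≢j with side x≢j | side y≢j
  ...   | inj₁ xj | inj₁ yj = λ xy≡0 →
    complete x y x≢y m (trans (sym (μ-b-both-into-j Q j xj yj)) xy≡0)
  ...   | inj₂ jx | inj₂ jy = λ xy≡0 →
    complete x y x≢y m (trans (sym (μ-b-both-out-of-j Q j jx jy)) xy≡0)
  ...   | inj₁ xj | inj₂ jy = ≢-sym (<⇒≢ (μ-shortcut-arrow xj jy x≢y m))
  ...   | inj₂ jx | inj₁ yj =
    <⇒≢ (arrow⇒reverse<0 (μ j Q) {y} {x} (μ-shortcut-arrow yj jx (≢-sym x≢y) (swap m)))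

  vortex-apex : ∀ {x y z} → Mutable Q x → Mutable Q y → x ≢ j → y ≢ j → z ≢ j →
    SourceIn Q j x y z ⊎ SinkIn Q j x y z →
    Arrow Q x y → Arrow Q y z → Arrow Q z x → IsVortexApex Q j
  vortex-apex {x} {y} {z} mx my x≢j y≢j z≢j source-or-sink xy yz zx =
    x , y , z , ≢-sym x≢j , ≢-sym y≢j , ≢-sym z≢j , distinct ,
    inj₁ (j-mutable , mx , my) , source-or-sink ,
    distinct , inj₁ (mx , my) , inj₁ (xy , yz , zx)
    where
    distinct : Distinct₃ x y z
    distinct = arrow⇒≢ Q xy , arrow⇒≢ Q yz , ≢-sym (arrow⇒≢ Q zx)

  μ-no-oriented-triangle-avoiding : ¬ IsVortexApex Q j → NoOrientedTriangleAvoiding (μ j Q) j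
  μ-no-oriented-triangle-avoiding no-vortex mx my x≢j y≢j z≢j xy yz zx
    with side x≢j | side y≢j | side z≢j
  ... | inj₁ xj | inj₁ yj | inj₁ zj = no-vortex (vortex-apex mx my x≢j y≢j z≢j
    (inj₂ (<⇒≤ (arrow⇒reverse<0 Q xj) , <⇒≤ (arrow⇒reverse<0 Q yj) , <⇒≤ (arrow⇒reverse<0 Q zj)))
    (μ-arrow-both-into-j Q j xj yj xy) (μ-arrow-both-into-j Q j yj zj yz)
    (μ-arrow-both-into-j Q j zj xj zx))
  ... | inj₂ jx | inj₂ jy | inj₂ jz = no-vortex (vortex-apex mx my x≢j y≢j z≢j
    (inj₁ (<⇒≤ jx , <⇒≤ jy , <⇒≤ jz))
    (μ-arrow-both-out-of-j Q j jx jy xy) (μ-arrow-both-out-of-j Q j jy jz yz)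
    (μ-arrow-both-out-of-j Q j jz jx zx))
  ... | inj₁ xj | inj₁ _  | inj₂ jz = μ-no-reverse-shortcut jz xj (inj₂ mx) zx
  ... | inj₁ _  | inj₂ jy | inj₁ zj = μ-no-reverse-shortcut jy zj (inj₁ my) yz
  ... | inj₁ xj | inj₂ _  | inj₂ jz = μ-no-reverse-shortcut jz xj (inj₂ mx) zx
  ... | inj₂ jx | inj₁ yj | inj₁ _  = μ-no-reverse-shortcut jx yj (inj₁ mx) xy
  ... | inj₂ jx | inj₁ yj | inj₂ _  = μ-no-reverse-shortcut jx yj (inj₁ mx) xy
  ... | inj₂ _  | inj₂ jy | inj₁ zj = μ-no-reverse-shortcut jy zj (inj₁ my) yz

theorem5p7 : ∀ {n} (Q : Quiver n) (j : Fin n) →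
    Complete Q → ExactlyTwoFrozen Q → Mutable Q j →
    CyclePreserving Q j → ¬ IsVortexApex Q j →
    Brog (μ j Q)
theorem5p7 Q j complete (u , v , _ , u-frozen , v-frozen , frozen-u-or-v)
           j-mutable preserving no-vortex =
  TwoFrozen.brog (μ j Q) j μ-complete j-mutable u v u-frozen v-frozen frozen-u-or-v
    μ-all-triangles-through-oriented (μ-no-oriented-triangle-avoiding no-vortex)
  where open CyclePreservingMutation Q j complete j-mutable preserving
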